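{- For every $\epsilon > 0$ there exist a constant $C_\epsilon$ (depending only on $\epsilon$) and $n_0(\epsilon)$ such that for every $n \geqslant n_0(\epsilon)$ and every set $X$ of $n$ integers contained in $\{1, \dots, 8n^3\}$, there exists $X' \subseteq X$ with $|X'| \geqslant (1/2 - \epsilon)|X|$ such that $X'$ can be compressed into a subset of the segment $\{1, \dots, \lfloor C_\epsilon n \ln n\rfloor\}$.
   Context: For a set of integers $X=\{x_1,\dots,x_m\}$ (distinct elements), a set $Y=\{y_1,\dots,y_m\}$ (distinct elements) is called a compression of $X$ if for all triples $(i,j,k)\in\{1,\dots,m\}^3$, the equality $x_i - 2x_j + x_k = 0$ implies $y_i - 2y_j + y_k = 0$. "$X$ can be compressed into a subset of $S$" means there exists a compression $Y$ of $X$ with $Y\subseteq S$.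
   Formalization: The parameter ε ranges over the positive rationals. -}

module Defs where

open import Data.Nat as ℕ using (ℕ; zero; suc; _!)
open import Data.Integer as ℤ using (ℤ; +_)
open import Data.Fin using (Fin)
open import Data.Product using (Σ; _×_)
open import Function.Definitions using (Injective)
open import Relation.Binary.PropositionalEquality using (_≡_)

IsCompression : ∀ {m} → (Fin m → ℤ) → (Fin m → ℤ) → Set
IsCompression {m} x y =
  Injective _≡_ _≡_ y ×
  (∀ i j k → (x i ℤ.- (+ 2) ℤ.* x j) ℤ.+ x k ≡ + 0 →
             (y i ℤ.- (+ 2) ℤ.* y j) ℤ.+ y k ≡ + 0)

CompressibleInto : ∀ {m} → (Fin m → ℤ) → (ℤ → Set) → Set
CompressibleInto {m} x S = Σ (Fin m → ℤ) λ y → IsCompression x y × (∀ i → S (y i))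

-- expSum m k = k! * Σ_{i=0}^{k} m^i / i!   (a natural number)
expSum : ℕ → ℕ → ℕ
expSum m zero = 1
expSum m (suc k) = suc k ℕ.* expSum m k ℕ.+ m ℕ.^ suc k

-- ExpLe m N  :⇔  e^m ≤ N   (all partial sums of the exponential series are ≤ N)
ExpLe : ℕ → ℕ → Set
ExpLe m N = ∀ k → expSum m k ℕ.≤ N ℕ.* (k !)

-- t ≤ ⌊C n ln n⌋  ⇔  t ≤ C n ln n  ⇔  e^t ≤ n^(C n)   (t, C, n natural, n ≥ 1)
LeCnLnN : ℕ → ℕ → ℕ → Set
LeCnLnN C n t = ExpLe t (n ℕ.^ (C ℕ.* n))

InSegment : ℕ → ℕ → ℤ → Set
InSegment C n z = Σ ℕ λ t → (z ≡ + t) × (1 ℕ.≤ t) × LeCnLnN C n t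

{-# OPTIONS --safe #-}
-- Reduce modulo a well-chosen q.  Keep one index per residue class, and of those the larger
-- half lying in [0, ⌈q/2⌉) or in [⌈q/2⌉, q).  Within such a window r_i + r_k and 2 r_j differ
-- by less than q, so x_i + x_k = 2 x_j, which gives r_i + r_k ≡ 2 r_j (mod q), forces
-- r_i + r_k = 2 r_j: y = 1 + (x mod q) is a compression into {1, …, q}.  This keeps at
-- least (n - d_q) / 2 indices, where d_q counts the discarded repeated residues.
-- Each repeated residue contributes a factor q to P = ∏_{i<j} |x_i - x_j| ≤ (8n³)^(n²).  If
-- d_q > n/K for every q ≤ M, then q^(n+1) ∣ P^K for all these q, hence lcm(1, …, M)^(n+1) ∣ P^K;
-- but lcm(1, …, M) ≥ 2^(M-1) (Nair), which is too large once M ≈ 3 K n log₂ n.  With K the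
-- denominator of ε this leaves (1/2 - ε) n indices, and e^M ≤ 2·16^M ≤ n^(41 K n) places
-- {1, …, M} inside {1, …, ⌊41 K n ln n⌋}.
module Submission where

open import Defs
open import Algebra.Bundles using (Monoid)
import Data.Fin as Fin
open import Data.Fin using (Fin; toℕ)
open import Data.Fin.Properties using (toℕ<n)
open import Data.Nat as ℕ
  using (ℕ; zero; suc; _+_; _*_; _^_; _∸_; _!; _≤_; _<_; z≤n; s≤s; ∣_-_∣; ⌊_/2⌋; ⌈_/2⌉;
         s≤s⁻¹; NonZero; ≢-nonZero; ≢-nonZero⁻¹; >-nonZero; >-nonZero⁻¹)
open import Data.Nat.Combinatorics using (nCk+nC[k+1]≡[n+1]C[k+1]; nC1≡n)
  renaming (_C_ to _choose_)
open import Data.Nat.Properties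
open import Data.Nat.Divisibility
  using (_∣_; divides; _∣0; 1∣_; 0∣⇒≡0; ∣1⇒≡1; ∣⇒≤; >⇒∤; ∣-trans; *-pres-∣; ∣n⇒∣m*n;
         *-cancelʳ-∣)
open import Data.Nat.DivMod using (_/_; _%_; m/n*n≡m; m≡m%n+[m/n]*n; m%n<n; %-distribˡ-+)
open import Data.Nat.GCD using (gcd; gcd[m,n]≢0; gcd[m,n]∣m; gcd[m,n]∣n)
open import Data.Nat.LCM using (lcm; m∣lcm[m,n]; n∣lcm[m,n]; gcd*lcm)
open import Data.Nat.Coprimality as Coprime using (Coprime; coprime-divisor; coprime-/gcd; 1-coprimeTo)
open import Data.Product using (Σ; Σ-syntax; ∃-syntax; _×_; _,_; proj₁; proj₂)
open import Data.Sum using (inj₁; inj₂)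
open import Data.Nat.Tactic.RingSolver using (solve-∀)
open import Data.Integer as ℤ using (ℤ; +_; +[1+_]; -[1+_])
open import Data.Rational as ℚ using (ℚ; mkℚ; 0ℚ; ½)
import Data.Rational.Properties as ℚ
open import Data.Rational.Unnormalised as ℚᵘ using (mkℚᵘ; *≤*)
import Data.Rational.Unnormalised.Properties as ℚᵘ
import Data.Integer.Properties as ℤ
import Data.Integer.Tactic.RingSolver as ℤ-Solver
open import Relation.Binary.PropositionalEquality
open import Relation.Nullary using (Dec; contradiction; yes; no; ¬_)
open import Relation.Unary using (Decidable)
open import Relation.Unary.Properties using (∁?)
open import Function using (_∘_)
open import Function.Definitions using (Injective)
open import Data.List using (List; []; _∷_; length; map; filter; lookup; allFin)
open import Data.List.Properties using (length-map; length-tabulate)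
open import Data.List.Relation.Unary.Unique.Propositional.Properties using (allFin⁺)
open import Data.List.Membership.Propositional using (find)
open import Data.List.Membership.Propositional.Properties using (∈-map⁺; ∈-lookup)
open import Data.List.Relation.Unary.All as All using (All; []; _∷_)
open import Data.List.Relation.Unary.All.Properties using (all-filter; ¬Any⇒All¬)
  renaming (map⁺ to All-map⁺)
open import Data.List.Relation.Unary.AllPairs as AllPairs using (AllPairs; []; _∷_)
import Data.List.Relation.Unary.AllPairs.Properties as AllPairs
open import Data.List.Relation.Unary.Any using (any?)
open import Data.Nat.ListAction using (product)
open import Data.Nat.ListAction.Properties using (∈⇒∣product; product≢0)

import Algebra.Properties.CommutativeSemiring.Binomial +-*-commutativeSemiring as Binomial
open import Algebra.Properties.Semiring.Sum +-*-semiring using (sum; sum-cong-≗; *-distribˡ-sum)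
open import Algebra.Definitions.RawMonoid (Monoid.rawMonoid +-0-monoid) using ()
  renaming (_×_ to _×′_)
open import Algebra.Definitions.RawMonoid (Monoid.rawMonoid *-1-monoid) using ()
  renaming (_×_ to _^′_)

^-distribʳ-* : ∀ m n i → (m * n) ^ i ≡ m ^ i * n ^ i
^-distribʳ-* m n zero = refl
^-distribʳ-* m n (suc i) =
  trans (cong (m * n *_) (^-distribʳ-* m n i)) (x*y*[z*w]≡x*z*[y*w] m n (m ^ i) (n ^ i))
  where
  x*y*[z*w]≡x*z*[y*w] : ∀ x y z w → x * y * (z * w) ≡ x * z * (y * w)
  x*y*[z*w]≡x*z*[y*w] = solve-∀

^-monoʳ-∣ : ∀ a {m n} → m ≤ n → a ^ m ∣ a ^ n
^-monoʳ-∣ a {m} {n} m≤n = divides (a ^ (n ∸ m)) (begin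
  a ^ n                ≡⟨ cong (a ^_) (sym (m+[n∸m]≡n m≤n)) ⟩
  a ^ (m + (n ∸ m))    ≡⟨ ^-distribˡ-+-* a m (n ∸ m) ⟩
  a ^ m * a ^ (n ∸ m)  ≡⟨ *-comm (a ^ m) (a ^ (n ∸ m)) ⟩
  a ^ (n ∸ m) * a ^ m  ∎)
  where open ≡-Reasoning

^-monoˡ-∣ : ∀ {d m} T → d ∣ m → d ^ T ∣ m ^ T
^-monoˡ-∣ {d} T (divides k m≡k*d) = divides (k ^ T) (trans (cong (_^ T) m≡k*d) (^-distribʳ-* k d T))

∣∧<⇒≡0 : ∀ {q d} → q ∣ d → d < q → d ≡ 0
∣∧<⇒≡0 {d = zero} _ _ = refl
∣∧<⇒≡0 {d = suc _} q∣d d<q = contradiction q∣d (>⇒∤ d<q)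

%≡%⇒∣∣-∣ : ∀ a b q .{{_ : NonZero q}} → a % q ≡ b % q → q ∣ ∣ a - b ∣
%≡%⇒∣∣-∣ a b q a≡b = divides ∣ a / q - b / q ∣ (begin
  ∣ a - b ∣                                  ≡⟨ cong₂ ∣_-_∣ (m≡m%n+[m/n]*n a q) (m≡m%n+[m/n]*n b q) ⟩
  ∣ a % q + a / q * q - b % q + b / q * q ∣  ≡⟨ cong (λ m → ∣ a % q + a / q * q - m + b / q * q ∣) (sym a≡b) ⟩
  ∣ a % q + a / q * q - a % q + b / q * q ∣  ≡⟨ ∣m+n-m+o∣≡∣n-o∣ (a % q) _ _ ⟩
  ∣ a / q * q - b / q * q ∣                  ≡⟨ sym (*-distribʳ-∣-∣ q (a / q) (b / q)) ⟩
  ∣ a / q - b / q ∣ * q                      ∎)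
  where open ≡-Reasoning

%-injective-nearby : ∀ {s t} q .{{_ : NonZero q}} → s % q ≡ t % q → s < t + q → t < s + q → s ≡ t
%-injective-nearby {s} {t} q s≡t s<t+q t<s+q =
  ∣m-n∣≡0⇒m≡n (∣∧<⇒≡0 (%≡%⇒∣∣-∣ s t q s≡t) ∣s-t∣<q)
  where
  ∣s-t∣<q : ∣ s - t ∣ < q
  ∣s-t∣<q with ∣m-n∣≡[m∸n]∨[n∸m] s t
  ... | inj₁ ∣s-t∣≡s∸t = subst (_< q) (sym ∣s-t∣≡s∸t) (m<n+o⇒m∸n<o s t s<t+q)
  ... | inj₂ ∣s-t∣≡t∸s = subst (_< q) (sym ∣s-t∣≡t∸s) (m<n+o⇒m∸n<o t s t<s+q)

log₂-bracket : ∀ n .{{_ : NonZero n}} → Σ[ ℓ ∈ ℕ ] 2 ^ ℓ ≤ n × n < 2 ^ suc ℓ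
log₂-bracket (suc zero) = 0 , ≤-refl , n<1+n 1
log₂-bracket (suc (suc n)) with log₂-bracket (suc n)
... | ℓ , 2^ℓ≤1+n , 1+n<2^[1+ℓ] with suc (suc n) <? 2 ^ suc ℓ
...   | yes 2+n<2^[1+ℓ] = ℓ , m≤n⇒m≤1+n 2^ℓ≤1+n , 2+n<2^[1+ℓ]
...   | no 2+n≮2^[1+ℓ] = suc ℓ , ≤-reflexive (sym 2+n≡2^[1+ℓ]) ,
          subst (_< 2 ^ suc (suc ℓ)) (sym 2+n≡2^[1+ℓ]) (^-monoʳ-< 2 (n<1+n 1) (n<1+n (suc ℓ)))
  where
  2+n≡2^[1+ℓ] : suc (suc n) ≡ 2 ^ suc ℓ
  2+n≡2^[1+ℓ] = ≤-antisym 1+n<2^[1+ℓ] (≮⇒≥ 2+n≮2^[1+ℓ])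

8n³≤2^[6+3ℓ] : ∀ {n} ℓ → n < 2 ^ suc ℓ → 8 * n ^ 3 ≤ 2 ^ (6 + 3 * ℓ)
8n³≤2^[6+3ℓ] {n} ℓ n<2^[1+ℓ] = begin
  8 * n ^ 3                ≤⟨ *-monoʳ-≤ 8 (^-monoˡ-≤ 3 (<⇒≤ n<2^[1+ℓ])) ⟩
  2 ^ 3 * (2 ^ suc ℓ) ^ 3  ≡⟨ cong (2 ^ 3 *_) (^-*-assoc 2 (suc ℓ) 3) ⟩
  2 ^ 3 * 2 ^ (suc ℓ * 3)  ≡⟨ sym (^-distribˡ-+-* 2 3 (suc ℓ * 3)) ⟩
  2 ^ (3 + suc ℓ * 3)      ≡⟨ cong (2 ^_) (exponent ℓ) ⟩
  2 ^ (6 + 3 * ℓ)          ∎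
  where
  open ≤-Reasoning
  exponent : ∀ ℓ → 3 + suc ℓ * 3 ≡ 6 + 3 * ℓ
  exponent = solve-∀

-- Binomial coefficients

nC0≡1 : ∀ n → n choose 0 ≡ 1
nC0≡1 zero = refl
nC0≡1 (suc n) = refl

choose-pascal : ∀ n k → suc n choose suc k ≡ n choose k + n choose suc k
choose-pascal n k = sym (nCk+nC[k+1]≡[n+1]C[k+1] n k)

choose-absorption : ∀ n k → suc k * (suc n choose suc k) ≡ suc n * (n choose k)
choose-absorption n zero = trans (*-identityˡ _) (trans (nC1≡n (suc n)) (sym (*-identityʳ _)))
choose-absorption zero (suc k) = *-zeroʳ (suc (suc k))
choose-absorption (suc n) (suc k) = begin
  (2 + k) * (suc (suc n) choose suc (suc k))  ≡⟨ cong ((2 + k) *_) (choose-pascal (suc n) (suc k)) ⟩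
  (2 + k) * (X + Y)                           ≡⟨ regroup k X Y ⟩
  X + ((1 + k) * X + (2 + k) * Y)             ≡⟨ cong (_+_ X) (cong₂ _+_ (choose-absorption n k)
                                                                       (choose-absorption n (suc k))) ⟩
  X + ((1 + n) * U + (1 + n) * V)  ≡⟨ cong (_+_ X) (sym (*-distribˡ-+ (1 + n) U V)) ⟩
  X + (1 + n) * (U + V)            ≡⟨ cong (λ z → X + (1 + n) * z) (sym (choose-pascal n k)) ⟩
  (2 + n) * X                      ∎
  where
  open ≡-Reasoning
  X = suc n choose suc k
  Y = suc n choose suc (suc k)
  U = n choose k
  V = n choose suc k
  regroup : ∀ k X Y → (2 + k) * (X + Y) ≡ X + ((1 + k) * X + (2 + k) * Y)
  regroup = solve-∀

nCk≤2^n : ∀ n k → n choose k ≤ 2 ^ n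
nCk≤2^n zero zero = ≤-refl
nCk≤2^n zero (suc k) = z≤n
nCk≤2^n (suc n) zero = m^n>0 2 (suc n)
nCk≤2^n (suc n) (suc k) = begin
  suc n choose suc k           ≡⟨ choose-pascal n k ⟩
  n choose k + n choose suc k  ≤⟨ +-mono-≤ (nCk≤2^n n k) (nCk≤2^n n (suc k)) ⟩
  2 ^ n + 2 ^ n                ≡⟨ cong (_+_ (2 ^ n)) (sym (+-identityʳ (2 ^ n))) ⟩
  2 ^ suc n                    ∎
  where open ≤-Reasoning

a^i≤i!*[a+i]Ci : ∀ a i → a ^ i ≤ i ! * ((a + i) choose i)
a^i≤i!*[a+i]Ci a zero = ≤-reflexive (sym (trans (*-identityˡ ((a + 0) choose 0)) (nC0≡1 (a + 0))))
a^i≤i!*[a+i]Ci a (suc i) = begin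
  a * a ^ i                                   ≤⟨ *-mono-≤ (m≤m+n a (suc i)) (a^i≤i!*[a+i]Ci a i) ⟩
  (a + suc i) * (i ! * ((a + i) choose i))    ≡⟨ cong (λ m → m * (i ! * ((a + i) choose i))) (+-suc a i) ⟩
  suc (a + i) * (i ! * ((a + i) choose i))    ≡⟨ x*[y*z]≡y*[x*z] (suc (a + i)) (i !) ((a + i) choose i) ⟩
  i ! * (suc (a + i) * ((a + i) choose i))    ≡⟨ cong (i ! *_) (sym (choose-absorption (a + i) i)) ⟩
  i ! * (suc i * (suc (a + i) choose suc i))  ≡⟨ sym (*-assoc (i !) (suc i) _) ⟩
  i ! * suc i * (suc (a + i) choose suc i)    ≡⟨ cong (_* (suc (a + i) choose suc i)) (*-comm (i !) (suc i)) ⟩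
  suc i ! * (suc (a + i) choose suc i)        ≡⟨ cong (λ m → suc i ! * (m choose suc i)) (sym (+-suc a i)) ⟩
  suc i ! * ((a + suc i) choose suc i)        ∎
  where
  open ≤-Reasoning
  x*[y*z]≡y*[x*z] : ∀ x y z → x * (y * z) ≡ y * (x * z)
  x*[y*z]≡y*[x*z] = solve-∀

∑nCk≡2^n : ∀ n → sum (λ (k : Fin (suc n)) → n choose toℕ k) ≡ 2 ^ n
∑nCk≡2^n n = begin
  sum {suc n} (λ k → n choose toℕ k)  ≡⟨ sum-cong-≗ {suc n} binomialTerm≡ ⟨
  Binomial.binomialExpansion 1 1 n    ≡⟨ Binomial.theorem n 1 1 ⟨
  n ^′ 2                              ≡⟨ ^′≡^ 2 n ⟩
  2 ^ n                               ∎
  where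
  open ≡-Reasoning
  ^′≡^ : ∀ m k → k ^′ m ≡ m ^ k
  ^′≡^ m zero = refl
  ^′≡^ m (suc k) = cong (m *_) (^′≡^ m k)
  ×′1 : ∀ m → m ×′ 1 ≡ m
  ×′1 zero = refl
  ×′1 (suc m) = cong suc (×′1 m)
  1^′ : ∀ c → c ^′ 1 ≡ 1
  1^′ c = trans (^′≡^ 1 c) (^-zeroˡ c)
  binomialTerm≡ : ∀ k → Binomial.binomialTerm 1 1 n k ≡ n choose toℕ k
  binomialTerm≡ k = trans (cong ((n choose toℕ k) ×′_) (cong₂ _*_ (1^′ (toℕ k)) (1^′ (n ∸ toℕ k))))
                          (×′1 (n choose toℕ k))

-- The exponential series

2^i*t^i≤16^t*i! : ∀ t i → 2 ^ i * t ^ i ≤ 16 ^ t * i !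
2^i*t^i≤16^t*i! t i = *-cancelˡ-≤ (2 ^ i) {{m^n≢0 2 i}} (begin
  2 ^ i * (2 ^ i * t ^ i)       ≡⟨ sym (*-assoc (2 ^ i) (2 ^ i) (t ^ i)) ⟩
  2 ^ i * 2 ^ i * t ^ i         ≡⟨ cong (_* t ^ i) (sym (^-distribʳ-* 2 2 i)) ⟩
  4 ^ i * t ^ i                 ≡⟨ sym (^-distribʳ-* 4 t i) ⟩
  (4 * t) ^ i                   ≤⟨ a^i≤i!*[a+i]Ci (4 * t) i ⟩
  i ! * ((4 * t + i) choose i)  ≤⟨ *-monoʳ-≤ (i !) (nCk≤2^n (4 * t + i) i) ⟩
  i ! * 2 ^ (4 * t + i)         ≡⟨ cong (i ! *_) (^-distribˡ-+-* 2 (4 * t) i) ⟩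
  i ! * (2 ^ (4 * t) * 2 ^ i)   ≡⟨ cong (λ m → i ! * (m * 2 ^ i)) (sym (^-*-assoc 2 4 t)) ⟩
  i ! * (16 ^ t * 2 ^ i)        ≡⟨ x*[y*z]≡z*[y*x] (i !) (16 ^ t) (2 ^ i) ⟩
  2 ^ i * (16 ^ t * i !)        ∎)
  where
  open ≤-Reasoning
  x*[y*z]≡z*[y*x] : ∀ x y z → x * (y * z) ≡ z * (y * x)
  x*[y*z]≡z*[y*x] = solve-∀

-- Summing the geometric majorants t^i / i! ≤ M / 2^i; the additive form of the
-- invariant avoids truncated subtraction.
ExpLe-geometric : ∀ {t M} → (∀ i → 2 ^ i * t ^ i ≤ M * i !) → ExpLe t (2 * M)
ExpLe-geometric {t} {M} bound k = *-cancelˡ-≤ (2 ^ k) {{m^n≢0 2 k}} (begin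
  2 ^ k * expSum t k            ≤⟨ m≤m+n _ (M * k !) ⟩
  2 ^ k * expSum t k + M * k !  ≤⟨ invariant k ⟩
  2 * 2 ^ k * M * k !           ≡⟨ regroup (2 ^ k) M (k !) ⟩
  2 ^ k * (2 * M * k !)         ∎)
  where
  open ≤-Reasoning
  regroup : ∀ p m f → 2 * p * m * f ≡ p * (2 * m * f)
  regroup = solve-∀
  invariant : ∀ k → 2 ^ k * expSum t k + M * k ! ≤ 2 * 2 ^ k * M * k !
  invariant zero = ≤-trans (+-monoˡ-≤ (M * 1) (bound 0)) (≤-reflexive (2*m≡2*1*m*1 M))
    where
    2*m≡2*1*m*1 : ∀ m → m * 1 + m * 1 ≡ 2 * 1 * m * 1
    2*m≡2*1*m*1 = solve-∀
  invariant (suc k) = +-cancelʳ-≤ (2 * M * (suc k * k !)) _ _ (begin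
    2 ^ suc k * expSum t (suc k) + M * suc k ! + 2 * M * (suc k * k !)
      ≡⟨ expand (2 ^ k) (expSum t k) M (k !) (t ^ suc k) k ⟩
    2 * suc k * (2 ^ k * expSum t k + M * k !) + (2 ^ suc k * t ^ suc k + M * suc k !)
      ≤⟨ +-mono-≤ (*-monoʳ-≤ (2 * suc k) (invariant k)) (+-monoˡ-≤ (M * suc k !) (bound (suc k))) ⟩
    2 * suc k * (2 * 2 ^ k * M * k !) + (M * suc k ! + M * suc k !)
      ≡⟨ collect (2 ^ k) M (k !) k ⟩
    2 * 2 ^ suc k * M * suc k ! + 2 * M * (suc k * k !) ∎)
    where
    expand : ∀ p e m f u k → 2 * p * ((1 + k) * e + u) + m * ((1 + k) * f) + 2 * m * ((1 + k) * f)
           ≡ 2 * (1 + k) * (p * e + m * f) + (2 * p * u + m * ((1 + k) * f))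
    expand = solve-∀
    collect : ∀ p m f k → 2 * (1 + k) * (2 * p * m * f) + (m * ((1 + k) * f) + m * ((1 + k) * f))
           ≡ 2 * (2 * p) * m * ((1 + k) * f) + 2 * m * ((1 + k) * f)
    collect = solve-∀

ExpLe-mono : ∀ {t N N′} → N ≤ N′ → ExpLe t N → ExpLe t N′
ExpLe-mono N≤N′ e k = ≤-trans (e k) (*-monoˡ-≤ (k !) N≤N′)

ExpLe-2*16^t : ∀ t → ExpLe t (2 * 16 ^ t)
ExpLe-2*16^t t = ExpLe-geometric {M = 16 ^ t} (2^i*t^i≤16^t*i! t)

-- 2 * 16^M = 2^(4M + 1), and 4M + 1 = 5 + 4 (6 + 3ℓ) K n ≤ (5 + 24 + 12) ℓ K n when ℓ, K, n ≥ 1.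
2*16^t≤n^[41Kn] : ∀ {n K t} ℓ → 2 ^ ℓ ≤ n → 1 ≤ ℓ → 1 ≤ n → 1 ≤ K →
                  t ≤ suc ((6 + 3 * ℓ) * K * n) → 2 * 16 ^ t ≤ n ^ (41 * K * n)
2*16^t≤n^[41Kn] {n} {K} {t} ℓ 2^ℓ≤n 1≤ℓ 1≤n 1≤K t≤M = begin
  2 * 16 ^ t              ≤⟨ *-monoʳ-≤ 2 (^-monoʳ-≤ 16 t≤M) ⟩
  2 * 16 ^ M              ≡⟨ cong (2 *_) (^-*-assoc 2 4 M) ⟩
  2 ^ suc (4 * M)         ≤⟨ ^-monoʳ-≤ 2 (exponent≤ 1≤ℓ 1≤K 1≤n) ⟩
  2 ^ (ℓ * (41 * K * n))  ≡⟨ sym (^-*-assoc 2 ℓ (41 * K * n)) ⟩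
  (2 ^ ℓ) ^ (41 * K * n)  ≤⟨ ^-monoˡ-≤ (41 * K * n) 2^ℓ≤n ⟩
  n ^ (41 * K * n)        ∎
  where
  open ≤-Reasoning
  M = suc ((6 + 3 * ℓ) * K * n)
  exponent≤ : ∀ {ℓ K n} → 1 ≤ ℓ → 1 ≤ K → 1 ≤ n →
              suc (4 * suc ((6 + 3 * ℓ) * K * n)) ≤ ℓ * (41 * K * n)
  exponent≤ {suc l} {suc k} {suc m} _ _ _ = ≤-trans (m≤m+n _ _) (≤-reflexive (sym (split l k m)))
    where
    split : ∀ l k m → (1 + l) * (41 * (1 + k) * (1 + m))
          ≡ suc (4 * suc ((6 + 3 * (1 + l)) * (1 + k) * (1 + m)))
            + (24 * l * (1 + k) * (1 + m) + 5 * (l + k + m + l * k + l * m + k * m + l * k * m))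
    split = solve-∀

-- Nair's lower bound for lcm(1, …, N)

-- The identities 1/a = 1/b - 1/c behind Nair's bound on lcm(1, …, n+1), with
-- a = (n+2) C(n+1,k+1), b = (n+1) C(n,k), c = (n+2) C(n+1,k), e = c - b = (k+1) C(n+1,k).
nair-sum : ∀ n k → suc (suc n) * (suc n choose k) ≡ suc n * (n choose k) + suc k * (suc n choose k)
nair-sum n zero = 2+n≡1+n+1 n
  where
  2+n≡1+n+1 : ∀ n → (2 + n) * 1 ≡ (1 + n) * 1 + 1 * 1
  2+n≡1+n+1 = solve-∀
nair-sum n (suc k) = begin
  (2 + n) * X                    ≡⟨ cong (λ m → X + (1 + n) * m) (choose-pascal n k) ⟩
  X + (1 + n) * (U + V)          ≡⟨ distrib X (1 + n) U V ⟩
  X + (1 + n) * U + (1 + n) * V  ≡⟨ cong (λ m → X + m + (1 + n) * V) (sym (choose-absorption n k)) ⟩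
  X + (1 + k) * X + (1 + n) * V  ≡⟨ regroup n k X V ⟩
  (1 + n) * V + (2 + k) * X      ∎
  where
  open ≡-Reasoning
  X = suc n choose suc k
  U = n choose k
  V = n choose suc k
  distrib : ∀ x m a b → x + m * (a + b) ≡ x + m * a + m * b
  distrib = solve-∀
  regroup : ∀ n k X V → X + (1 + k) * X + (1 + n) * V ≡ (1 + n) * V + (2 + k) * X
  regroup = solve-∀

nair-product : ∀ n k → (suc (suc n) * (suc n choose suc k)) * (suc k * (suc n choose k))
                     ≡ (suc n * (n choose k)) * (suc (suc n) * (suc n choose k))
nair-product n k = begin
  ((2 + n) * X) * ((1 + k) * Y)             ≡⟨ swap (2 + n) X (1 + k) Y ⟩
  ((1 + k) * X) * ((2 + n) * Y)             ≡⟨ cong (_* ((2 + n) * Y)) (choose-absorption n k) ⟩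
  ((1 + n) * (n choose k)) * ((2 + n) * Y)  ∎
  where
  open ≡-Reasoning
  X = suc n choose suc k
  Y = suc n choose k
  swap : ∀ a x b y → (a * x) * (b * y) ≡ (b * x) * (a * y)
  swap = solve-∀

∣-reciprocal-difference : ∀ {a b c e L} → c ≡ b + e → a * e ≡ b * c → b ∣ L → c ∣ L → a ∣ L
∣-reciprocal-difference {a} {zero} _ _ 0∣L _ = subst (a ∣_) (sym (0∣⇒≡0 0∣L)) (a ∣0)
∣-reciprocal-difference {a} {b@(suc _)} {c} {e} {L} c≡b+e ae≡bc (divides u L≡ub) (divides v L≡vc) =
  divides (u ∸ v) (*-cancelˡ-≡ L ((u ∸ v) * a) b (begin
    b * L              ≡⟨ cong (b *_) L≡vc ⟩
    b * (v * c)        ≡⟨ x*[y*z]≡y*[x*z] b v c ⟩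
    v * (b * c)        ≡⟨ cong (v *_) (sym ae≡bc) ⟩
    v * (a * e)        ≡⟨ x*[y*z]≡y*[x*z] v a e ⟩
    a * (v * e)        ≡⟨ cong (a *_) (sym [u∸v]*b≡v*e) ⟩
    a * ((u ∸ v) * b)  ≡⟨ x*[y*z]≡z*[y*x] a (u ∸ v) b ⟩
    b * ((u ∸ v) * a)  ∎))
  where
  open ≡-Reasoning
  x*[y*z]≡y*[x*z] : ∀ x y z → x * (y * z) ≡ y * (x * z)
  x*[y*z]≡y*[x*z] = solve-∀
  x*[y*z]≡z*[y*x] : ∀ x y z → x * (y * z) ≡ z * (y * x)
  x*[y*z]≡z*[y*x] = solve-∀
  [u∸v]*b≡v*e : (u ∸ v) * b ≡ v * e
  [u∸v]*b≡v*e = begin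
    (u ∸ v) * b            ≡⟨ *-distribʳ-∸ b u v ⟩
    u * b ∸ v * b          ≡⟨ cong (_∸ v * b) (trans (sym L≡ub) L≡vc) ⟩
    v * c ∸ v * b          ≡⟨ cong (λ m → v * m ∸ v * b) c≡b+e ⟩
    v * (b + e) ∸ v * b    ≡⟨ cong (_∸ v * b) (*-distribˡ-+ v b e) ⟩
    v * b + v * e ∸ v * b  ≡⟨ m+n∸m≡n (v * b) (v * e) ⟩
    v * e                  ∎

nair-∣ : ∀ {L N} → (∀ q → q < N → suc q ∣ L) → ∀ n k → k ≤ n → n < N → suc n * (n choose k) ∣ L
nair-∣ {L} ∣L n zero _ n<N = subst (_∣ L) (sym (*-identityʳ (suc n))) (∣L n n<N)
nair-∣ ∣L (suc n) (suc k) (s≤s k≤n) n<N =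
  ∣-reciprocal-difference (nair-sum n k) (nair-product n k)
    (nair-∣ ∣L n k k≤n (<-trans (n<1+n n) n<N))
    (nair-∣ ∣L (suc n) k (m≤n⇒m≤1+n k≤n) n<N)

sum-≤ : ∀ {m c} (f : Fin m → ℕ) → (∀ i → f i ≤ c) → sum f ≤ m * c
sum-≤ {zero} f _ = z≤n
sum-≤ {suc m} f f≤c = +-mono-≤ (f≤c Fin.zero) (sum-≤ (f ∘ Fin.suc) (f≤c ∘ Fin.suc))

2^n≤lcm : ∀ {L} n → .{{NonZero L}} → (∀ q → q < suc n → suc q ∣ L) → 2 ^ n ≤ L
2^n≤lcm {L} n ∣L = *-cancelˡ-≤ (suc n) (begin
  suc n * 2 ^ n                                 ≡⟨ cong (suc n *_) (sym (∑nCk≡2^n n)) ⟩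
  suc n * sum {suc n} (λ k → n choose toℕ k)    ≡⟨ *-distribˡ-sum {suc n} (suc n) (λ k → n choose toℕ k) ⟩
  sum {suc n} (λ k → suc n * (n choose toℕ k))  ≤⟨ sum-≤ _ (λ k → ∣⇒≤ ([1+n]*nCk∣L k)) ⟩
  suc n * L                                     ∎)
  where
  open ≤-Reasoning
  [1+n]*nCk∣L : (k : Fin (suc n)) → suc n * (n choose toℕ k) ∣ L
  [1+n]*nCk∣L k = nair-∣ ∣L n (toℕ k) (s≤s⁻¹ (toℕ<n k)) (n<1+n n)

coprime-*ʳ : ∀ {m n o} → Coprime m n → Coprime m o → Coprime m (n * o)
coprime-*ʳ m⊥n m⊥o (d∣m , d∣n*o) = m⊥o (d∣m , coprime-divisor d⊥n d∣n*o)
  where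
  d⊥n : Coprime _ _
  d⊥n (e∣d , e∣n) = m⊥n (∣-trans e∣d d∣m , e∣n)

coprime-^ʳ : ∀ {m n} T → Coprime m n → Coprime m (n ^ T)
coprime-^ʳ zero _ (_ , d∣1) = ∣1⇒≡1 d∣1
coprime-^ʳ (suc T) m⊥n = coprime-*ʳ m⊥n (coprime-^ʳ T m⊥n)

coprime-^ : ∀ {m n} T → Coprime m n → Coprime (m ^ T) (n ^ T)
coprime-^ T m⊥n = Coprime.sym (coprime-^ʳ T (Coprime.sym (coprime-^ʳ T m⊥n)))

-- With g = gcd a b: a = a′ g and b = c g with a′, c coprime, and lcm a b = a c.
lcm-^-∣ : ∀ {a b P} T → a ^ T ∣ P → b ^ T ∣ P → lcm a b ^ T ∣ P
lcm-^-∣ {zero} T aᵀ∣P _ = aᵀ∣P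
lcm-^-∣ {a@(suc _)} {b} {P} T (divides k P≡k*aᵀ) bᵀ∣P = divides k′ (begin
  P                     ≡⟨ P≡k*aᵀ ⟩
  k * a ^ T             ≡⟨ cong (_* a ^ T) k≡k′*cᵀ ⟩
  k′ * c ^ T * a ^ T    ≡⟨ x*y*z≡x*[z*y] k′ (c ^ T) (a ^ T) ⟩
  k′ * (a ^ T * c ^ T)  ≡⟨ cong (k′ *_) (sym (^-distribʳ-* a c T)) ⟩
  k′ * (a * c) ^ T      ∎)
  where
  open ≡-Reasoning
  g = gcd a b
  instance
    g≢0 : NonZero g
    g≢0 = ≢-nonZero (gcd[m,n]≢0 a b (inj₁ λ ()))
  a′ = a / g
  c = b / g
  x*y*z≡x*[z*y] : ∀ x y z → x * y * z ≡ x * (z * y)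
  x*y*z≡x*[z*y] = solve-∀
  cᵀ*gᵀ∣a′ᵀ*k*gᵀ : c ^ T * g ^ T ∣ a′ ^ T * k * g ^ T
  cᵀ*gᵀ∣a′ᵀ*k*gᵀ = subst₂ _∣_
    (trans (cong (_^ T) (sym (m/n*n≡m (gcd[m,n]∣n a b)))) (^-distribʳ-* c g T))
    (begin
      P                     ≡⟨ P≡k*aᵀ ⟩
      k * a ^ T             ≡⟨ cong (λ m → k * m ^ T) (sym (m/n*n≡m (gcd[m,n]∣m a b))) ⟩
      k * (a′ * g) ^ T      ≡⟨ cong (k *_) (^-distribʳ-* a′ g T) ⟩
      k * (a′ ^ T * g ^ T)  ≡⟨ x*[y*z]≡y*x*z k (a′ ^ T) (g ^ T) ⟩
      a′ ^ T * k * g ^ T    ∎)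
    bᵀ∣P
    where
    x*[y*z]≡y*x*z : ∀ x y z → x * (y * z) ≡ y * x * z
    x*[y*z]≡y*x*z = solve-∀
  cᵀ∣k : c ^ T ∣ k
  cᵀ∣k = coprime-divisor (coprime-^ T (Coprime.sym (coprime-/gcd a b)))
           (*-cancelʳ-∣ (g ^ T) {{m^n≢0 g T}} cᵀ*gᵀ∣a′ᵀ*k*gᵀ)
  open _∣_ cᵀ∣k renaming (quotient to k′; equality to k≡k′*cᵀ)

lcm≢0 : ∀ m n .{{_ : NonZero m}} .{{_ : NonZero n}} → NonZero (lcm m n)
lcm≢0 m n = ≢-nonZero λ lcm≡0 → ≢-nonZero⁻¹ (m * n) {{m*n≢0 m n}}
  (trans (sym (gcd*lcm m n)) (trans (cong (gcd m n *_) lcm≡0) (*-zeroʳ (gcd m n))))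

lcmUpTo : ℕ → ℕ
lcmUpTo zero = 1
lcmUpTo (suc N) = lcm (suc N) (lcmUpTo N)

lcmUpTo≢0 : ∀ N → NonZero (lcmUpTo N)
lcmUpTo≢0 zero = _
lcmUpTo≢0 (suc N) = lcm≢0 (suc N) (lcmUpTo N) {{_}} {{lcmUpTo≢0 N}}

∣lcmUpTo : ∀ {q N} → q < N → suc q ∣ lcmUpTo N
∣lcmUpTo {q} {suc N} q<1+N with m≤n⇒m<n∨m≡n (s≤s⁻¹ q<1+N)
... | inj₁ q<N = ∣-trans (∣lcmUpTo q<N) (n∣lcm[m,n] (suc N) (lcmUpTo N))
... | inj₂ refl = m∣lcm[m,n] (suc N) (lcmUpTo N)

lcmUpTo-^-∣ : ∀ {P} T N → (∀ q → q < N → suc q ^ T ∣ P) → lcmUpTo N ^ T ∣ P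
lcmUpTo-^-∣ {P} T zero _ = subst (_∣ P) (sym (^-zeroˡ T)) (1∣ P)
lcmUpTo-^-∣ T (suc N) ∣P =
  lcm-^-∣ {suc N} {lcmUpTo N} T (∣P N (n<1+n N))
    (lcmUpTo-^-∣ T N (λ q q<N → ∣P q (m<n⇒m<1+n q<N)))

2^[n*T]≤ : ∀ {P} n T → .{{NonZero P}} → (∀ q → q < suc n → suc q ^ T ∣ P) → 2 ^ (n * T) ≤ P
2^[n*T]≤ {P} n T ∣P = begin
  2 ^ (n * T)          ≡⟨ sym (^-*-assoc 2 n T) ⟩
  (2 ^ n) ^ T          ≤⟨ ^-monoˡ-≤ T (2^n≤lcm n {{lcmUpTo≢0 (suc n)}} (λ q → ∣lcmUpTo)) ⟩
  lcmUpTo (suc n) ^ T  ≤⟨ ∣⇒≤ (lcmUpTo-^-∣ T (suc n) ∣P) ⟩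
  P                    ∎
  where open ≤-Reasoning

-- Compressions modulo q

PreservesAPs : ∀ {m} → (Fin m → ℕ) → (Fin m → ℕ) → Set
PreservesAPs a b = ∀ i j k → a i + a k ≡ a j + a j → b i + b k ≡ b j + b j

lookup-injective : ∀ {A : Set} (f : A → ℕ) {l} → AllPairs (λ u v → f u ≢ f v) l →
                   Injective _≡_ _≡_ (f ∘ lookup l)
lookup-injective f {_ ∷ _} _ {Fin.zero} {Fin.zero} _ = refl
lookup-injective f {_ ∷ _} (v≢vs ∷ _) {Fin.zero} {Fin.suc j} fv≡fw =
  contradiction fv≡fw (All.lookup v≢vs (∈-lookup j))
lookup-injective f {_ ∷ _} (v≢vs ∷ _) {Fin.suc i} {Fin.zero} fw≡fv =
  contradiction (sym fw≡fv) (All.lookup v≢vs (∈-lookup i))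
lookup-injective f {_ ∷ _} (_ ∷ vs-distinct) {Fin.suc i} {Fin.suc j} fvᵢ≡fvⱼ =
  cong Fin.suc (lookup-injective f vs-distinct fvᵢ≡fvⱼ)

[u-2v]+w≡[u+w]-[v+v] : ∀ u v w → (+ u ℤ.- + 2 ℤ.* + v) ℤ.+ + w ≡ + (u + w) ℤ.- + (v + v)
[u-2v]+w≡[u+w]-[v+v] u v w =
  trans (regroup (+ u) (+ v) (+ w)) (sym (cong₂ ℤ._-_ (ℤ.pos-+ u w) (ℤ.pos-+ v v)))
  where
  regroup : ∀ u v w → (u ℤ.- + 2 ℤ.* v) ℤ.+ w ≡ (u ℤ.+ w) ℤ.- (v ℤ.+ v)
  regroup = ℤ-Solver.solve-∀

IsCompression-fromℕ : ∀ {m} {x : Fin m → ℤ} {a b : Fin m → ℕ} → (∀ i → x i ≡ + a i) →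
                      Injective _≡_ _≡_ b → PreservesAPs a b → IsCompression x (λ i → + b i)
IsCompression-fromℕ {x = x} {a} {b} x≡a b-injective b-preserves =
  b-injective ∘ ℤ.+-injective , λ i j k xAP → ℕ-AP⇒ℤ-AP (b-preserves i j k (ℤ-AP⇒ℕ-AP i j k xAP))
  where
  ℤ-AP⇒ℕ-AP : ∀ i j k → (x i ℤ.- + 2 ℤ.* x j) ℤ.+ x k ≡ + 0 → a i + a k ≡ a j + a j
  ℤ-AP⇒ℕ-AP i j k xAP rewrite x≡a i | x≡a j | x≡a k =
    ℤ.+-injective (ℤ.i-j≡0⇒i≡j _ _ (trans (sym ([u-2v]+w≡[u+w]-[v+v] (a i) (a j) (a k))) xAP))
  ℕ-AP⇒ℤ-AP : ∀ {i j k} → b i + b k ≡ b j + b j → (+ b i ℤ.- + 2 ℤ.* + b j) ℤ.+ + b k ≡ + 0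
  ℕ-AP⇒ℤ-AP {i} {j} {k} bAP =
    trans ([u-2v]+w≡[u+w]-[v+v] (b i) (b j) (b k)) (ℤ.i≡j⇒i-j≡0 (cong +_ bAP))

PreservesAPs-suc : ∀ {m} {a b : Fin m → ℕ} → PreservesAPs a b → PreservesAPs a (suc ∘ b)
PreservesAPs-suc {b = b} b-preserves i j k aAP = begin
  suc (b i) + suc (b k)  ≡⟨ cong suc (+-suc (b i) (b k)) ⟩
  2 + (b i + b k)        ≡⟨ cong (_+_ 2) (b-preserves i j k aAP) ⟩
  2 + (b j + b j)        ≡⟨ cong suc (sym (+-suc (b j) (b j))) ⟩
  suc (b j) + suc (b j)  ∎
  where open ≡-Reasoning

InWindow : ℕ → ℕ → ℕ → Set
InWindow L w r = L ≤ r × r < L + w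

window-+-bounds : ∀ {q L w x y} → w + w ≤ suc q → InWindow L w x → InWindow L w y →
                  L + L ≤ x + y × x + y < L + L + q
window-+-bounds {q} {L} {w} {x} {y} 2w≤1+q (L≤x , x<L+w) (L≤y , y<L+w) =
  +-mono-≤ L≤x L≤y , s≤s⁻¹ (begin
    suc (suc (x + y))  ≡⟨ cong suc (sym (+-suc x y)) ⟩
    suc x + suc y      ≤⟨ +-mono-≤ x<L+w y<L+w ⟩
    (L + w) + (L + w)  ≡⟨ +-comm-middle L w ⟩
    (L + L) + (w + w)  ≤⟨ +-monoʳ-≤ (L + L) 2w≤1+q ⟩
    (L + L) + suc q    ≡⟨ +-suc (L + L) q ⟩
    suc (L + L + q)    ∎)
  where
  open ≤-Reasoning
  +-comm-middle : ∀ a b → (a + b) + (a + b) ≡ (a + a) + (b + b)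
  +-comm-middle = solve-∀

window-AP : ∀ {q L w u v s} .{{_ : NonZero q}} → w + w ≤ suc q →
            InWindow L w u → InWindow L w v → InWindow L w s →
            (u + s) % q ≡ (v + v) % q → u + s ≡ v + v
window-AP {q} 2w≤1+q u∈ v∈ s∈ u+s≡2v =
  %-injective-nearby q u+s≡2v
    (<-≤-trans (proj₂ us) (+-monoˡ-≤ q (proj₁ vv)))
    (<-≤-trans (proj₂ vv) (+-monoˡ-≤ q (proj₁ us)))
  where
  us = window-+-bounds 2w≤1+q u∈ s∈
  vv = window-+-bounds 2w≤1+q v∈ v∈

length-filter+length-filter-∁ : ∀ {A : Set} {P : A → Set} (P? : Decidable P) xs →
  length (filter P? xs) + length (filter (∁? P?) xs) ≡ length xs
length-filter+length-filter-∁ P? [] = refl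
length-filter+length-filter-∁ P? (x ∷ xs) with P? x
... | yes _ = cong suc (length-filter+length-filter-∁ P? xs)
... | no _ = trans (+-suc _ _) (cong suc (length-filter+length-filter-∁ P? xs))

module _ {A : Set} (a : A → ℕ) (q : ℕ) .{{_ : NonZero q}} where

  window-preserves-APs : ∀ {L w} → w + w ≤ suc q →
                         (S : List A) → All (λ v → InWindow L w (a v % q)) S →
                         PreservesAPs (a ∘ lookup S) (λ i → a (lookup S i) % q)
  window-preserves-APs 2w≤1+q S in-window i j k aᵢ+aₖ≡2aⱼ =
    window-AP 2w≤1+q (in-window-at i) (in-window-at j) (in-window-at k) (begin
      (r i + r k) % q    ≡⟨ sym (%-distribˡ-+ (a (lookup S i)) (a (lookup S k)) q) ⟩
      (aₗ i + aₗ k) % q  ≡⟨ cong (_% q) aᵢ+aₖ≡2aⱼ ⟩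
      (aₗ j + aₗ j) % q  ≡⟨ %-distribˡ-+ (a (lookup S j)) (a (lookup S j)) q ⟩
      (r j + r j) % q    ∎)
    where
    open ≡-Reasoning
    aₗ = a ∘ lookup S
    r = λ i → aₗ i % q
    in-window-at = λ i → All.lookup in-window (∈-lookup i)

  HalfCompressible : List A → Set
  HalfCompressible l =
    Σ[ S ∈ List A ] length l ≤ length S + length S ×
                    Injective _≡_ _≡_ (λ i → a (lookup S i) % q) ×
                    PreservesAPs (a ∘ lookup S) (λ i → a (lookup S i) % q)

  half-compression : ∀ l → AllPairs (λ u v → a u % q ≢ a v % q) l → HalfCompressible l
  half-compression l distinct = larger-half (length lo ≤? length hi)
    where
    lo? : Decidable (λ v → a v % q < ⌈ q /2⌉)
    lo? v = a v % q <? ⌈ q /2⌉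
    hi? = ∁? lo?
    lo = filter lo? l
    hi = filter hi? l
    split-≤ : ∀ {m} → length lo + length hi ≤ m → length l ≤ m
    split-≤ = subst (_≤ _) (length-filter+length-filter-∁ lo? l)
    injective-on : ∀ {P : A → Set} (P? : Decidable P) →
                   Injective _≡_ _≡_ (λ i → a (lookup (filter P? l) i) % q)
    injective-on P? = lookup-injective (λ v → a v % q) (AllPairs.filter⁺ P? distinct)
    ⌈q/2⌉+⌊q/2⌋≡q : ⌈ q /2⌉ + ⌊ q /2⌋ ≡ q
    ⌈q/2⌉+⌊q/2⌋≡q = trans (+-comm ⌈ q /2⌉ ⌊ q /2⌋) (⌊n/2⌋+⌈n/2⌉≡n q)
    2⌈q/2⌉≤1+q : ⌈ q /2⌉ + ⌈ q /2⌉ ≤ suc q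
    2⌈q/2⌉≤1+q = ≤-trans (+-monoʳ-≤ ⌈ q /2⌉ (⌊n/2⌋≤⌈n/2⌉ (suc q)))
                         (≤-reflexive (⌊n/2⌋+⌈n/2⌉≡n (suc q)))
    2⌊q/2⌋≤1+q : ⌊ q /2⌋ + ⌊ q /2⌋ ≤ suc q
    2⌊q/2⌋≤1+q = ≤-trans (+-monoʳ-≤ ⌊ q /2⌋ (⌊n/2⌋≤⌈n/2⌉ q))
                         (≤-trans (≤-reflexive (⌊n/2⌋+⌈n/2⌉≡n q)) (n≤1+n q))
    below-q : ∀ v → a v % q < ⌈ q /2⌉ + ⌊ q /2⌋
    below-q v = subst (a v % q <_) (sym ⌈q/2⌉+⌊q/2⌋≡q) (m%n<n (a v) q)
    larger-half : Dec (length lo ≤ length hi) → HalfCompressible l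
    larger-half (yes lo≤hi) =
      hi , split-≤ (+-monoˡ-≤ (length hi) lo≤hi) , injective-on hi? ,
      window-preserves-APs 2⌊q/2⌋≤1+q hi (All.map (λ {v} ¬low → ≮⇒≥ ¬low , below-q v) (all-filter hi? l))
    larger-half (no lo≰hi) =
      lo , split-≤ (+-monoʳ-≤ (length lo) (<⇒≤ (≰⇒> lo≰hi))) , injective-on lo? ,
      window-preserves-APs 2⌈q/2⌉≤1+q lo (All.map (z≤n ,_) (all-filter lo? l))

-- Few duplicate residues

module Dedup {A : Set} (key : A → ℕ) where

  dedup : List A → List A
  dedup [] = []
  dedup (v ∷ vs) with any? (λ w → key v ≟ key w) vs
  ... | yes _ = dedup vs
  ... | no _ = v ∷ dedup vs

  duplicates : List A → ℕ
  duplicates [] = 0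
  duplicates (v ∷ vs) with any? (λ w → key v ≟ key w) vs
  ... | yes _ = suc (duplicates vs)
  ... | no _ = duplicates vs

  length-dedup : ∀ l → length (dedup l) + duplicates l ≡ length l
  length-dedup [] = refl
  length-dedup (v ∷ vs) with any? (λ w → key v ≟ key w) vs
  ... | yes _ = trans (+-suc _ _) (cong suc (length-dedup vs))
  ... | no _ = cong suc (length-dedup vs)

  All-dedup : ∀ {P : A → Set} {l} → All P l → All P (dedup l)
  All-dedup {l = []} [] = []
  All-dedup {l = v ∷ vs} (pv ∷ pvs) with any? (λ w → key v ≟ key w) vs
  ... | yes _ = All-dedup pvs
  ... | no _ = pv ∷ All-dedup pvs

  dedup-distinct : ∀ l → AllPairs (λ u v → key u ≢ key v) (dedup l)
  dedup-distinct [] = []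
  dedup-distinct (v ∷ vs) with any? (λ w → key v ≟ key w) vs
  ... | yes _ = dedup-distinct vs
  ... | no ¬twin = All-dedup (¬Any⇒All¬ vs ¬twin) ∷ dedup-distinct vs

module _ {A : Set} (a : A → ℕ) where

  distances : A → List A → List ℕ
  distances v = map (λ w → ∣ a v - a w ∣)

  distanceProduct : List A → ℕ
  distanceProduct [] = 1
  distanceProduct (v ∷ vs) = product (distances v vs) * distanceProduct vs

  distanceProduct≢0 : ∀ {l} → AllPairs (λ u v → a u ≢ a v) l → NonZero (distanceProduct l)
  distanceProduct≢0 [] = _
  distanceProduct≢0 {v ∷ vs} (v≢vs ∷ vs-distinct) =
    m*n≢0 _ _ {{product≢0 (All-map⁺ (All.map (λ v≢w → ≢-nonZero (v≢w ∘ ∣m-n∣≡0⇒m≡n)) v≢vs))}}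
              {{distanceProduct≢0 vs-distinct}}

  ^-duplicates-∣-distanceProduct : ∀ q .{{_ : NonZero q}} l →
    q ^ Dedup.duplicates (λ v → a v % q) l ∣ distanceProduct l
  ^-duplicates-∣-distanceProduct q [] = 1∣ 1
  ^-duplicates-∣-distanceProduct q (v ∷ vs) with any? (λ w → a v % q ≟ a w % q) vs
  ... | yes twin = *-pres-∣ q∣row (^-duplicates-∣-distanceProduct q vs)
    where
    q∣row : q ∣ product (distances v vs)
    q∣row with find twin
    ... | w , w∈vs , v≡w = ∣-trans (%≡%⇒∣∣-∣ (a v) (a w) q v≡w) (∈⇒∣product (∈-map⁺ _ w∈vs))
  ... | no _ = ∣n⇒∣m*n (product (distances v vs)) (^-duplicates-∣-distanceProduct q vs)

  distanceProduct≤ : ∀ {D} .{{_ : NonZero D}} → (∀ u v → ∣ a u - a v ∣ ≤ D) →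
                     ∀ l → distanceProduct l ≤ D ^ (length l * length l)
  distanceProduct≤ _ [] = ≤-refl
  distanceProduct≤ {D} ∣-∣≤D (v ∷ vs) = begin
    product (distances v vs) * distanceProduct vs  ≤⟨ *-mono-≤ row≤ (distanceProduct≤ ∣-∣≤D vs) ⟩
    D ^ k * D ^ (k * k)                            ≡⟨ sym (^-distribˡ-+-* D k (k * k)) ⟩
    D ^ (k + k * k)                                ≤⟨ ^-monoʳ-≤ D k+k*k≤[1+k]*[1+k] ⟩
    D ^ (suc k * suc k)                            ∎
    where
    open ≤-Reasoning
    k = length vs
    k+k*k≤[1+k]*[1+k] : k + k * k ≤ suc k * suc k
    k+k*k≤[1+k]*[1+k] = ≤-trans (m≤n+m _ (suc k)) (≤-reflexive (square k))
      where
      square : ∀ k → suc k + (k + k * k) ≡ suc k * suc k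
      square = solve-∀
    product≤^length : ∀ ns → All (_≤ D) ns → product ns ≤ D ^ length ns
    product≤^length [] [] = ≤-refl
    product≤^length (m ∷ ms) (m≤D ∷ ms≤D) = *-mono-≤ m≤D (product≤^length ms ms≤D)
    row≤ : product (distances v vs) ≤ D ^ k
    row≤ = subst (λ e → product (distances v vs) ≤ D ^ e) (length-map _ vs)
             (product≤^length _ (All-map⁺ (All.universal (∣-∣≤D v) vs)))

-- If every modulus up to M left more than length l / K duplicates, then lcm(1, …, M)^(n+1)
-- would divide distanceProduct^K ≤ 2^(B n² K), which is too small once M > B K n.
few-duplicates : ∀ {A : Set} (a : A → ℕ) (l : List A) K B .{{_ : NonZero K}} .{{_ : NonZero B}}
  .{{_ : NonZero (length l)}} → AllPairs (λ u v → a u ≢ a v) l → (∀ u v → ∣ a u - a v ∣ ≤ 2 ^ B) →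
  Σ[ q ∈ ℕ ] q < suc (B * K * length l) × Dedup.duplicates (λ v → a v % suc q) l * K ≤ length l
few-duplicates a l K B distinct ∣-∣≤2^B
  with anyUpTo? (λ q → Dedup.duplicates (λ v → a v % suc q) l * K ≤? length l) (suc (B * K * length l))
... | yes good = good
... | no none = contradiction (2^[n*T]≤ (B * K * n) (suc n) {{m^n≢0 P K}} [1+q]ⁿ⁺¹∣Pᴷ) Pᴷ-too-small
  where
  n = length l
  P = distanceProduct a l
  instance
    P≢0 : NonZero P
    P≢0 = distanceProduct≢0 a distinct
  [1+q]ⁿ⁺¹∣Pᴷ : ∀ q → q < suc (B * K * n) → suc q ^ suc n ∣ P ^ K
  [1+q]ⁿ⁺¹∣Pᴷ q q<M = ∣-trans (^-monoʳ-∣ (suc q) n<d*K)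
    (subst (_∣ P ^ K) (^-*-assoc (suc q) d K) (^-monoˡ-∣ K (^-duplicates-∣-distanceProduct a (suc q) l)))
    where
    d = Dedup.duplicates (λ v → a v % suc q) l
    n<d*K : n < d * K
    n<d*K = ≰⇒> (none ∘ (q ,_) ∘ (q<M ,_))
  BKn>0 : 0 < B * K * n
  BKn>0 = >-nonZero⁻¹ (B * K * n) {{m*n≢0 (B * K) n {{m*n≢0 B K}}}}
  Pᴷ-too-small : ¬ (2 ^ (B * K * n * suc n) ≤ P ^ K)
  Pᴷ-too-small = <⇒≱ (begin-strict
    P ^ K                              ≤⟨ ^-monoˡ-≤ K (distanceProduct≤ a {{m^n≢0 2 B}} ∣-∣≤2^B l) ⟩
    ((2 ^ B) ^ (n * n)) ^ K            ≡⟨ cong (_^ K) (^-*-assoc 2 B (n * n)) ⟩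
    (2 ^ (B * (n * n))) ^ K            ≡⟨ ^-*-assoc 2 (B * (n * n)) K ⟩
    2 ^ (B * (n * n) * K)              <⟨ ^-monoʳ-< 2 (n<1+n 1) (m<m+n (B * (n * n) * K) BKn>0) ⟩
    2 ^ (B * (n * n) * K + B * K * n)  ≡⟨ cong (2 ^_) (expand B K n) ⟩
    2 ^ (B * K * n * suc n)            ∎)
    where
    open ≤-Reasoning
    expand : ∀ B K n → B * (n * n) * K + B * K * n ≡ B * K * n * suc n
    expand = solve-∀

+m-+n≤+o : ∀ {m n o} → m ≤ o + n → + m ℤ.- + n ℤ.≤ + o
+m-+n≤+o {n = n} {o} m≤o+n = ℤ.≤-trans (ℤ.+-monoˡ-≤ (ℤ.- + n) (ℤ.+≤+ m≤o+n))
  (ℤ.≤-reflexive (trans (cong (ℤ._- + n) (ℤ.pos-+ o n)) (cancel (+ o) (+ n))))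
  where
  cancel : ∀ i j → (i ℤ.+ j) ℤ.- j ≡ i
  cancel = ℤ-Solver.solve-∀

n/1≡mkℚ : ∀ n → + n ℚ./ 1 ≡ mkℚ (+ n) 0 (Coprime.sym (1-coprimeTo n))
n/1≡mkℚ n = ℚ.normalize-coprime (Coprime.sym (1-coprimeTo n))

-- ε = p/K with p ≥ 1 and c ≤ n/K, so (1/2 - ε) n ≤ n/2 - c ≤ (n - c)/2 ≤ m, checked after
-- clearing the denominator 2K.
½-ε-bound : ∀ ε → 0ℚ ℚ.< ε → ∀ {n m c} → c * ℚ.denominatorℕ ε ≤ n → n ≤ m + m + c →
            (½ ℚ.- ε) ℚ.* (+ n ℚ./ 1) ℚ.≤ + m ℚ./ 1
½-ε-bound (mkℚ (+ 0) _ _) 0<ε with () ← ℤ.Positive.pos (ℚ.positive 0<ε)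
½-ε-bound (mkℚ -[1+ _ ] _ _) 0<ε with () ← ℤ.Positive.pos (ℚ.positive 0<ε)
½-ε-bound (mkℚ +[1+ p ] d coprime) _ {n} {m} {c} c*K≤n n≤2m+c =
  ℚ.toℚᵘ-cancel-≤ (ℚᵘ.≤-respˡ-≃ (ℚᵘ.≃-sym lhs≃) (ℚᵘ.≤-respʳ-≃ (ℚᵘ.≃-sym rhs≃) (*≤* cleared)))
  where
  ε = mkℚ +[1+ p ] d coprime
  K = suc d
  lhs≃ : ℚ.toℚᵘ ((½ ℚ.- ε) ℚ.* (+ n ℚ./ 1))
         ℚᵘ.≃ (mkℚᵘ (+ 1) 1 ℚᵘ.- mkℚᵘ +[1+ p ] d) ℚᵘ.* mkℚᵘ (+ n) 0
  lhs≃ = ℚᵘ.≃-trans (ℚ.toℚᵘ-homo-* (½ ℚ.- ε) (+ n ℚ./ 1)) (ℚᵘ.*-cong ½-ε≃ n≃)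
    where
    ½-ε≃ = ℚᵘ.≃-trans (ℚ.toℚᵘ-homo-+ ½ (ℚ.- ε)) (ℚᵘ.+-congʳ (ℚ.toℚᵘ ½) (ℚ.toℚᵘ-homo‿- ε))
    n≃ = ℚᵘ.≃-reflexive (cong ℚ.toℚᵘ (n/1≡mkℚ n))
  rhs≃ : ℚ.toℚᵘ (+ m ℚ./ 1) ℚᵘ.≃ mkℚᵘ (+ m) 0
  rhs≃ = ℚᵘ.≃-reflexive (cong ℚ.toℚᵘ (n/1≡mkℚ m))
  Kn≤2Km+2[1+p]n : K * n ≤ m * (2 * K * 1) + 2 * suc p * n
  Kn≤2Km+2[1+p]n = begin
    K * n                            ≤⟨ *-monoʳ-≤ K n≤2m+c ⟩
    K * (m + m + c)                  ≡⟨ distribute K m c ⟩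
    m * (2 * K * 1) + c * K          ≤⟨ +-monoʳ-≤ (m * (2 * K * 1)) c*K≤n ⟩
    m * (2 * K * 1) + n              ≤⟨ +-monoʳ-≤ (m * (2 * K * 1)) (m≤n*m n (2 * suc p)) ⟩
    m * (2 * K * 1) + 2 * suc p * n  ∎
    where
    open ≤-Reasoning
    distribute : ∀ K m c → K * (m + m + c) ≡ m * (2 * K * 1) + c * K
    distribute = solve-∀
  cleared : ((+ 1 ℤ.* + K ℤ.+ -[1+ p ] ℤ.* + 2) ℤ.* + n) ℤ.* + 1 ℤ.≤ + m ℤ.* + (2 * K * 1)
  cleared = subst₂ ℤ._≤_ (sym numerator≡) (ℤ.pos-* m (2 * K * 1)) (+m-+n≤+o Kn≤2Km+2[1+p]n)
    where
    expand : ∀ K P N → ((+ 1 ℤ.* K ℤ.+ (ℤ.- P) ℤ.* + 2) ℤ.* N) ℤ.* + 1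
                     ≡ K ℤ.* N ℤ.- (+ 2 ℤ.* P ℤ.* N)
    expand = ℤ-Solver.solve-∀
    numerator≡ : ((+ 1 ℤ.* + K ℤ.+ -[1+ p ] ℤ.* + 2) ℤ.* + n) ℤ.* + 1
               ≡ + (K * n) ℤ.- + (2 * suc p * n)
    numerator≡ = trans (expand (+ K) (+ suc p) (+ n))
      (cong₂ ℤ._-_ (sym (ℤ.pos-* K n))
                   (trans (cong (ℤ._* + n) (sym (ℤ.pos-* 2 (suc p)))) (sym (ℤ.pos-* (2 * suc p) n))))

-- c counts the discarded repeated residues and b v = 1 + (a v mod q) for the chosen modulus q.
LargeCompressibleSubset : ℕ → (n : ℕ) → (Fin n → ℕ) → Set
LargeCompressibleSubset K n a =
  Σ[ S ∈ List (Fin n) ] Σ[ c ∈ ℕ ] Σ[ b ∈ (Fin n → ℕ) ]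
    c * K ≤ n × n ≤ length S + length S + c ×
    Injective _≡_ _≡_ (b ∘ lookup S) × PreservesAPs (a ∘ lookup S) (b ∘ lookup S) ×
    (∀ v → 1 ≤ b v × LeCnLnN (41 * K) n (b v))

large-compressible-subset : ∀ K .{{_ : NonZero K}} n → 2 ≤ n → (a : Fin n → ℕ) →
  Injective _≡_ _≡_ a → (∀ v → a v ≤ 8 * n ^ 3) → LargeCompressibleSubset K n a
large-compressible-subset K n 2≤n a a-injective a≤8n³ =
  from-modulus (few-duplicates a (allFin n) K B distinct ∣a-a∣≤2^B)
  where
  1≤n : 1 ≤ n
  1≤n = ≤-trans (n≤1+n 1) 2≤n
  bracket = log₂-bracket n {{>-nonZero 1≤n}}
  ℓ = proj₁ bracket
  2^ℓ≤n = proj₁ (proj₂ bracket)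
  n<2^[1+ℓ] = proj₂ (proj₂ bracket)
  1≤ℓ : 1 ≤ ℓ
  1≤ℓ = positive ℓ n<2^[1+ℓ]
    where
    positive : ∀ ℓ → n < 2 ^ suc ℓ → 1 ≤ ℓ
    positive zero n<2 = contradiction 2≤n (<⇒≱ n<2)
    positive (suc _) _ = s≤s z≤n
  B = 6 + 3 * ℓ
  ∣a-a∣≤2^B : ∀ u v → ∣ a u - a v ∣ ≤ 2 ^ B
  ∣a-a∣≤2^B u v = ≤-trans (∣m-n∣≤m⊔n (a u) (a v)) (⊔-lub (a≤2^B u) (a≤2^B v))
    where
    a≤2^B = λ v → ≤-trans (a≤8n³ v) (8n³≤2^[6+3ℓ] ℓ n<2^[1+ℓ])
  length-allFin : length (allFin n) ≡ n
  length-allFin = length-tabulate (λ i → i)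
  instance
    length≢0 : NonZero (length (allFin n))
    length≢0 = >-nonZero (subst (1 ≤_) (sym length-allFin) 1≤n)
  distinct : AllPairs (λ u v → a u ≢ a v) (allFin n)
  distinct = AllPairs.map (λ u≢v → u≢v ∘ a-injective) (allFin⁺ n)
  module Residues (q : ℕ) .{{_ : NonZero q}} = Dedup (λ v → a v % q)
  covered : ∀ q .{{_ : NonZero q}} (S : List (Fin n)) →
            length (Residues.dedup q (allFin n)) ≤ length S + length S →
            n ≤ length S + length S + Residues.duplicates q (allFin n)
  covered q S half = begin
    n                                                  ≡⟨ sym length-allFin ⟩
    length (allFin n)                                  ≡⟨ sym (Residues.length-dedup q (allFin n)) ⟩
    length (Residues.dedup q (allFin n)) + duplicates  ≤⟨ +-monoˡ-≤ duplicates half ⟩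
    length S + length S + duplicates                   ∎
    where
    open ≤-Reasoning
    duplicates = Residues.duplicates q (allFin n)
  in-segment : ∀ {q} → q < suc (B * K * n) →
               ∀ v → 1 ≤ suc (a v % suc q) × LeCnLnN (41 * K) n (suc (a v % suc q))
  in-segment {q} q<M v = s≤s z≤n , ExpLe-mono
    (2*16^t≤n^[41Kn] ℓ 2^ℓ≤n 1≤ℓ 1≤n (>-nonZero⁻¹ K) (≤-trans (m%n<n (a v) (suc q)) q<M))
    (ExpLe-2*16^t (suc (a v % suc q)))
  from-modulus : Σ[ q ∈ ℕ ] q < suc (B * K * length (allFin n)) ×
                            Residues.duplicates (suc q) (allFin n) * K ≤ length (allFin n) →
                 LargeCompressibleSubset K n a
  from-modulus (q , q<M , few)
    with half-compression a (suc q) (Residues.dedup (suc q) (allFin n))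
                                    (Residues.dedup-distinct (suc q) (allFin n))
  ... | S , half , r-injective , r-preserves =
    S , Residues.duplicates (suc q) (allFin n) , (λ v → suc (a v % suc q)) ,
    subst (Residues.duplicates (suc q) (allFin n) * K ≤_) length-allFin few , covered (suc q) S half ,
    r-injective ∘ suc-injective ,
    PreservesAPs-suc {a = a ∘ lookup S} {b = λ i → a (lookup S i) % suc q} r-preserves ,
    in-segment (subst (λ m → q < suc (B * K * m)) length-allFin q<M)

ℕ-valued : ∀ {n N} (x : Fin n → ℤ) → Injective _≡_ _≡_ x → (∀ i → (+ 1 ℤ.≤ x i) × (x i ℤ.≤ + N)) →
           Σ[ a ∈ (Fin n → ℕ) ] (∀ i → x i ≡ + a i) × Injective _≡_ _≡_ a × (∀ i → a i ≤ N)
ℕ-valued {N = N} x x-injective x-bounds =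
  (λ i → ℤ.∣ x i ∣) , x≡+∣x∣ ,
  (λ {i} {j} ∣xᵢ∣≡∣xⱼ∣ → x-injective (trans (x≡+∣x∣ i) (trans (cong +_ ∣xᵢ∣≡∣xⱼ∣) (sym (x≡+∣x∣ j))))) ,
  (λ i → ℤ.drop‿+≤+ (subst (ℤ._≤ + N) (x≡+∣x∣ i) (proj₂ (x-bounds i))))
  where
  x≡+∣x∣ : ∀ i → x i ≡ + ℤ.∣ x i ∣
  x≡+∣x∣ i = sym (ℤ.0≤i⇒+∣i∣≡i (ℤ.≤-trans (ℤ.+≤+ z≤n) (proj₁ (x-bounds i))))

lemma3 : (ε : ℚ) → 0ℚ ℚ.< ε →
    ∃[ C ] ∃[ n₀ ] ((n : ℕ) → n₀ ℕ.≤ n →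
      (x : Fin n → ℤ) → Injective _≡_ _≡_ x →
      (∀ i → (+ 1 ℤ.≤ x i) × (x i ℤ.≤ + (8 ℕ.* n ℕ.^ 3))) →
      ∃[ m ] Σ (Fin m → Fin n) λ σ →
        Injective _≡_ _≡_ σ ×
        ((½ ℚ.- ε) ℚ.* (+ n ℚ./ 1) ℚ.≤ (+ m ℚ./ 1)) ×
        CompressibleInto (x ∘ σ) (InSegment C n))
lemma3 ε 0<ε = 41 * K , 2 , λ n 2≤n x x-injective x-bounds →
  compress x 2≤n (ℕ-valued x x-injective x-bounds)
  where
  K = ℚ.denominatorℕ ε
  Compressed : (n : ℕ) → (Fin n → ℤ) → Set
  Compressed n x = ∃[ m ] Σ (Fin m → Fin n) λ σ → Injective _≡_ _≡_ σ ×
    ((½ ℚ.- ε) ℚ.* (+ n ℚ./ 1) ℚ.≤ (+ m ℚ./ 1)) × CompressibleInto (x ∘ σ) (InSegment (41 * K) n)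
  conclude : ∀ {n} {x : Fin n → ℤ} {a} → (∀ i → x i ≡ + a i) →
             LargeCompressibleSubset K n a → Compressed n x
  conclude x≡+a (S , c , b , c*K≤n , n≤2|S|+c , b-injective , b-preserves , b-in-segment) =
    length S , lookup S , b-injective ∘ cong b , ½-ε-bound ε 0<ε {m = length S} {c = c} c*K≤n n≤2|S|+c ,
    (λ i → + b (lookup S i)) , IsCompression-fromℕ (x≡+a ∘ lookup S) b-injective b-preserves ,
    λ i → b (lookup S i) , refl , b-in-segment (lookup S i)
  compress : ∀ {n} (x : Fin n → ℤ) → 2 ≤ n →
    Σ[ a ∈ (Fin n → ℕ) ] (∀ i → x i ≡ + a i) × Injective _≡_ _≡_ a × (∀ i → a i ≤ 8 * n ^ 3) →
    Compressed n x
  compress x 2≤n (a , x≡+a , a-injective , a≤8n³) =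
    conclude x≡+a (large-compressible-subset K _ 2≤n a a-injective a≤8n³)
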